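{- For every term $M$ of the state-bounded calculus (i.e. $M=N^*$ for a closed typable $N$ of $T^{\mathtt R}$) and every $n\ge4$, $\mathrm{Succ}(M,n,n)\ge1-\frac1n$.
   Context: Types $\sigma,\tau::=\mathbb N\mid\sigma\to\tau\mid\sigma\times\tau$; $T^{\mathtt R}$ terms $M,N::=x\mid\lambda x.M\mid MN\mid\langle M,N\rangle\mid\pi_1\mid\pi_2\mid\mathtt{rec}\mid\mathtt 0\mid\mathtt S\mid\mathtt R$, simply typed with $\mathtt 0:\mathbb N$, $\mathtt S:\mathbb N\to\mathbb N$, $\mathtt{rec}:(\sigma\times(\mathbb N\to\sigma\to\sigma)\times\mathbb N)\to\sigma$, $\pi_1:(\sigma\times\tau)\to\sigma$, $\pi_2:(\sigma\times\tau)\to\tau$, $\mathtt R:\mathbb N$. Numerals $\mathbf 0=\mathtt 0$, $\mathbf{n+1}=\mathtt S\mathbf n$. Values: closed terms of $V,W::=\lambda x.M\mid\pi_1\mid\pi_2\mid\langle V,W\rangle\mid\mathtt{rec}\mid\mathtt 0\mid\mathtt S\mid\mathtt SV$. State-bounded calculus: add a constant $\mathtt{SR}:\mathbb N$, let $N^*=N[\mathtt{SR}/\mathtt R]$; configurations are triples $(N^*,m,n)$, $m,n\in\mathbb N$. Reduction maps configurations to subdistributions of configurations by weak call-by-value rules with the state unchanged: $((\lambda x.M)V,m,n)\to\{(M[V/x],m,n)\}$; if $(M,m,n)\to\mu$ then $(MV,m,n)\to\mu V$; if $(N,m,n)\to\nu$ then $(MN,m,n)\to M\nu$; pairs left then right;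 $(\mathtt{rec}\langle U,V,\mathtt 0\rangle,m,n)\to\{(U,m,n)\}$; $(\mathtt{rec}\langle U,V,\mathtt S\mathbf k\rangle,m,n)\to\{(V\mathbf k(\mathtt{rec}\langle U,V,\mathbf k\rangle),m,n)\}$; projections of pairs; and $(\mathtt{SR},m,n)\to\{(\mathbf k,m+n,n)\mapsto2^{ -(k+1)}\mid k<m\}$. Lifted to distributions by reducing reducible configurations and keeping value configurations; $\mathrm{Succ}(M,m,n)$ is the total mass of the limit distribution of value configurations reached from $\{(M,m,n)\}$. -}

module Defs where

open import Data.Bool using (Bool; true; false; if_then_else_; _∧_)
open import Data.Nat as ℕ using (ℕ; zero; suc; _≡ᵇ_; _<ᵇ_; pred)
open import Data.List using (List; []; _∷_; map; upTo; concatMap; foldr)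
open import Data.Product using (_×_; _,_)
open import Data.Integer using (+_)
open import Data.Rational as ℚ using (ℚ; 0ℚ; 1ℚ; ½; _*_; _+_)

infixr 7 _⇒_
infixr 8 _⊗_
data Ty : Set where
  nat : Ty
  _⇒_ : Ty → Ty → Ty
  _⊗_ : Ty → Ty → Ty

-- Untyped (Curry-style) terms, de Bruijn indices.
-- tR is the constant R of T^R; tSR is the constant SR of the
-- state-bounded calculus.

data Term : Set where
  tvar  : ℕ → Term
  tlam  : Term → Term
  tapp  : Term → Term → Term
  tpair : Term → Term → Term
  tπ₁ tπ₂ trec tzero tsuc tR tSR : Term

-- Typing of T^R (no rule for SR: typable terms are T^R terms).
-- Triples  σ × τ × ρ  are right-nested:  σ ⊗ (τ ⊗ ρ),  ⟨U,V,k⟩ = ⟨U,⟨V,k⟩⟩.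
data _∋_∶_ : List Ty → ℕ → Ty → Set where
  here  : ∀ {Γ σ} → (σ ∷ Γ) ∋ zero ∶ σ
  there : ∀ {Γ σ τ i} → Γ ∋ i ∶ σ → (τ ∷ Γ) ∋ suc i ∶ σ

data _⊢_∶_ : List Ty → Term → Ty → Set where
  ⊢var  : ∀ {Γ i σ} → Γ ∋ i ∶ σ → Γ ⊢ tvar i ∶ σ
  ⊢lam  : ∀ {Γ M σ τ} → (σ ∷ Γ) ⊢ M ∶ τ → Γ ⊢ tlam M ∶ (σ ⇒ τ)
  ⊢app  : ∀ {Γ M N σ τ} → Γ ⊢ M ∶ (σ ⇒ τ) → Γ ⊢ N ∶ σ → Γ ⊢ tapp M N ∶ τ
  ⊢pair : ∀ {Γ M N σ τ} → Γ ⊢ M ∶ σ → Γ ⊢ N ∶ τ → Γ ⊢ tpair M N ∶ (σ ⊗ τ)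
  ⊢π₁   : ∀ {Γ σ τ} → Γ ⊢ tπ₁ ∶ ((σ ⊗ τ) ⇒ σ)
  ⊢π₂   : ∀ {Γ σ τ} → Γ ⊢ tπ₂ ∶ ((σ ⊗ τ) ⇒ τ)
  ⊢rec  : ∀ {Γ σ} → Γ ⊢ trec ∶ ((σ ⊗ ((nat ⇒ σ ⇒ σ) ⊗ nat)) ⇒ σ)
  ⊢zero : ∀ {Γ} → Γ ⊢ tzero ∶ nat
  ⊢suc  : ∀ {Γ} → Γ ⊢ tsuc ∶ (nat ⇒ nat)
  ⊢R    : ∀ {Γ} → Γ ⊢ tR ∶ nat

star : Term → Term
star (tvar i)    = tvar i
star (tlam M)    = tlam (star M)
star (tapp M N)  = tapp (star M) (star N)
star (tpair M N) = tpair (star M) (star N)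
star tR          = tSR
star t           = t

num : ℕ → Term
num zero    = tzero
num (suc k) = tapp tsuc (num k)

isValue : Term → Bool
isValue (tlam _)       = true
isValue tπ₁            = true
isValue tπ₂            = true
isValue (tpair V W)    = isValue V ∧ isValue W
isValue trec           = true
isValue tzero          = true
isValue tsuc           = true
isValue (tapp tsuc V)  = isValue V
isValue _              = false

-- substitution of a closed term V for index k (no shifting of V needed)
subst : ℕ → Term → Term → Term
subst k V (tvar i)    = if i ≡ᵇ k then V else (if k <ᵇ i then tvar (pred i) else tvar i)
subst k V (tlam M)    = tlam (subst (suc k) V M)
subst k V (tapp M N)  = tapp (subst k V M) (subst k V N)
subst k V (tpair M N) = tpair (subst k V M) (subst k V N)
subst k V t           = t

Config : Set
Config = Term × ℕ × ℕ

Dist : Set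
Dist = List (ℚ × Config)

halfPow : ℕ → ℚ
halfPow zero    = ½
halfPow (suc k) = ½ * halfPow k

data Step : Set where
  stuck : Step
  go    : Dist → Step

mapS : (Term → Term) → Step → Step
mapS f stuck  = stuck
mapS f (go d) = go (map (λ { (p , (t , a , b)) → (p , (f t , a , b)) }) d)

redex : Term → Term → ℕ → ℕ → Step
redex (tlam B) V m n = go ((1ℚ , (subst zero V B , m , n)) ∷ [])
redex tπ₁ (tpair V W) m n = go ((1ℚ , (V , m , n)) ∷ [])
redex tπ₂ (tpair V W) m n = go ((1ℚ , (W , m , n)) ∷ [])
redex trec (tpair U (tpair V tzero)) m n = go ((1ℚ , (U , m , n)) ∷ [])
redex trec (tpair U (tpair V (tapp tsuc K))) m n =
  go ((1ℚ , (tapp (tapp V K) (tapp trec (tpair U (tpair V K))) , m , n)) ∷ [])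
redex _ _ m n = stuck

-- weak call-by-value: in an application the argument is reduced first
-- (rule (MN) → Mν), then the function (rule (MV) → μV); pairs left then right.
step : Term → ℕ → ℕ → Step
step (tapp M N) m n with isValue N
... | false = mapS (λ N′ → tapp M N′) (step N m n)
... | true with isValue M
...   | false = mapS (λ M′ → tapp M′ N) (step M m n)
...   | true  = redex M N m n
step (tpair M N) m n with isValue M
... | false = mapS (λ M′ → tpair M′ N) (step M m n)
... | true with isValue N
...   | false = mapS (λ N′ → tpair M N′) (step N m n)
...   | true  = stuck
step tSR m n = go (map (λ k → (halfPow k , (num k , m ℕ.+ n , n))) (upTo m))
step _ m n = stuck

liftStep : Dist → Dist
liftStep = concatMap f
  where
  f : ℚ × Config → Dist
  f (p , (t , m , n)) with isValue t
  ... | true  = (p , (t , m , n)) ∷ []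
  ... | false with step t m n
  ...   | stuck = (p , (t , m , n)) ∷ []
  ...   | go d  = map (λ { (q , c) → (p * q , c) }) d

iterate : ℕ → Dist → Dist
iterate zero    d = d
iterate (suc k) d = iterate k (liftStep d)

valueMass : Dist → ℚ
valueMass = foldr (λ { (p , (t , _ , _)) acc → if isValue t then p + acc else acc }) 0ℚ

-- The masses valueMass (iterate k ...) are non-decreasing in k, and
-- Succ(M,m,n) is their limit = supremum.  "Succ(M,m,n) ≥ q" is rendered as
-- "for every rational ε > 0 some k has mass ≥ q - ε".
SuccAtLeast : Term → ℕ → ℕ → ℚ → Set
SuccAtLeast M m n q =
  (ε : ℚ) → 0ℚ ℚ.< ε →
  Data.Product.∃ λ k → (q ℚ.- ε) ℚ.≤ valueMass (iterate k ((1ℚ , (M , m , n)) ∷ []))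

-- 1/n (n ≥ 1; value at 0 irrelevant)
recipℕ : ℕ → ℚ
recipℕ zero    = 0ℚ
recipℕ (suc m) = + 1 ℚ./ suc m

-- A reducibility argument shows that every typable term has an evaluation tree: all runs terminate,
-- and they branch only where SR is sampled. Sampling SR in state m reaches the values k < m with total
-- probability 1 - 2^-m and moves to state m + n. By induction on the tree, the mass that has reached
-- values after finitely many steps from state m is at least 1 - 2·2^-m, because
-- (1 - 2^-m)(1 - 2·2^-(m+n)) ≥ 1 - 2·2^-m as soon as n ≥ 1. For n ≥ 4 finally 2·2^-n ≤ 1/n.
module Submission where

open import Defs
open import Data.Bool using (true; false)
import Data.Integer as ℤ
open import Data.List using (List; []; _∷_; _++_; length; map; upTo; applyUpTo; foldr)
open import Data.List.Properties using (map-∘; map-applyUpTo; concatMap-++; ++-identityʳ)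
open import Data.List.Relation.Binary.Pointwise using (Pointwise; []; _∷_; Pointwise-length)
open import Data.List.Relation.Unary.All using (All; []; _∷_)
open import Data.List.Relation.Unary.All.Properties using (++⁺)
open import Data.Nat as ℕ using (ℕ; zero; suc; pred; _≤_; _<_; _≡ᵇ_; _<ᵇ_; z≤n; s≤s)
import Data.Nat.Properties as ℕP
open import Data.Product using (_×_; _,_; proj₂; ∃-syntax; ∃₂)
open import Data.Rational as ℚ using (ℚ; 0ℚ; 1ℚ; ½; _+_; _*_; _-_; toℚᵘ)
import Data.Rational.Properties as QP
import Data.Rational.Unnormalised as ℚᵘ
import Data.Rational.Unnormalised.Properties as ℚᵘP
open import Data.Sum using (inj₁; inj₂)
open import Data.Unit using (⊤; tt)
open import Function using (_∘_; id)
open import Level using (0ℓ)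
open import Relation.Binary.Definitions using (tri<; tri≈; tri>)
open import Relation.Binary.PropositionalEquality as Eq
  using (_≡_; _≢_; refl; sym; trans; cong; cong₂; module ≡-Reasoning)
open import Relation.Nullary using (contradiction)
open import Relation.Nullary.Decidable using (dec⇒maybe; toWitness)
open import Tactic.RingSolver using (solve-∀)
open import Tactic.RingSolver.Core.AlmostCommutativeRing using (AlmostCommutativeRing; fromCommutativeRing)

-- Scoping and closing substitutions

Scoped : ℕ → Term → Set
Scoped d (tvar i)    = i < d
Scoped d (tlam M)    = Scoped (suc d) M
Scoped d (tapp M N)  = Scoped d M × Scoped d N
Scoped d (tpair M N) = Scoped d M × Scoped d N
Scoped d _           = ⊤

Closed : Term → Set
Closed = Scoped 0

Scoped-weaken : ∀ {d d′} M → d ≤ d′ → Scoped d M → Scoped d′ M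
Scoped-weaken (tvar i)    d≤d′ i<d       = ℕP.<-≤-trans i<d d≤d′
Scoped-weaken (tlam M)    d≤d′ sM        = Scoped-weaken M (s≤s d≤d′) sM
Scoped-weaken (tapp M N)  d≤d′ (sM , sN) = Scoped-weaken M d≤d′ sM , Scoped-weaken N d≤d′ sN
Scoped-weaken (tpair M N) d≤d′ (sM , sN) = Scoped-weaken M d≤d′ sM , Scoped-weaken N d≤d′ sN
Scoped-weaken tπ₁   _ _ = tt
Scoped-weaken tπ₂   _ _ = tt
Scoped-weaken trec  _ _ = tt
Scoped-weaken tzero _ _ = tt
Scoped-weaken tsuc  _ _ = tt
Scoped-weaken tR    _ _ = tt
Scoped-weaken tSR   _ _ = tt

Closed⇒Scoped : ∀ {d} V → Closed V → Scoped d V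
Closed⇒Scoped V = Scoped-weaken V z≤n

≢⇒≡ᵇ≡false : ∀ {m n} → m ≢ n → (m ≡ᵇ n) ≡ false
≢⇒≡ᵇ≡false {zero}  {zero}  m≢n = contradiction refl m≢n
≢⇒≡ᵇ≡false {zero}  {suc n} _   = refl
≢⇒≡ᵇ≡false {suc m} {zero}  _   = refl
≢⇒≡ᵇ≡false {suc m} {suc n} m≢n = ≢⇒≡ᵇ≡false (m≢n ∘ cong suc)

≤⇒<ᵇ≡false : ∀ {m n} → n ≤ m → (m <ᵇ n) ≡ false
≤⇒<ᵇ≡false z≤n     = refl
≤⇒<ᵇ≡false (s≤s p) = ≤⇒<ᵇ≡false p

<⇒<ᵇ≡true : ∀ {m n} → m < n → (m <ᵇ n) ≡ true
<⇒<ᵇ≡true {zero}  (s≤s _) = refl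
<⇒<ᵇ≡true {suc m} (s≤s p) = <⇒<ᵇ≡true p

subst-var-< : ∀ {k i} V → i < k → subst k V (tvar i) ≡ tvar i
subst-var-< {k} {i} V i<k
  rewrite ≢⇒≡ᵇ≡false (ℕP.<⇒≢ i<k) | ≤⇒<ᵇ≡false (ℕP.<⇒≤ i<k) = refl

subst-var-≡ : ∀ k V → subst k V (tvar k) ≡ V
subst-var-≡ k V with k ≡ᵇ k | ℕP.≡⇒≡ᵇ k k refl
... | true | _ = refl

subst-var-> : ∀ {k i} V → k < i → subst k V (tvar i) ≡ tvar (pred i)
subst-var-> {k} {i} V k<i
  rewrite ≢⇒≡ᵇ≡false (ℕP.>⇒≢ k<i) | <⇒<ᵇ≡true k<i = refl

subst-id : ∀ {d k} V M → Scoped d M → d ≤ k → subst k V M ≡ M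
subst-id V (tvar i)    i<d       d≤k = subst-var-< V (ℕP.<-≤-trans i<d d≤k)
subst-id V (tlam M)    sM        d≤k = cong tlam (subst-id V M sM (s≤s d≤k))
subst-id V (tapp M N)  (sM , sN) d≤k = cong₂ tapp (subst-id V M sM d≤k) (subst-id V N sN d≤k)
subst-id V (tpair M N) (sM , sN) d≤k = cong₂ tpair (subst-id V M sM d≤k) (subst-id V N sN d≤k)
subst-id V tπ₁   _ _ = refl
subst-id V tπ₂   _ _ = refl
subst-id V trec  _ _ = refl
subst-id V tzero _ _ = refl
subst-id V tsuc  _ _ = refl
subst-id V tR    _ _ = refl
subst-id V tSR   _ _ = refl

subst-Scoped : ∀ {d k} V M → Closed V → d ≤ k → Scoped (suc k) M → Scoped k (subst d V M)
subst-Scoped {d} V (tvar i) cV d≤k i<1+k with ℕP.<-cmp i d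
... | tri< i<d _ _ rewrite subst-var-< V i<d = ℕP.<-≤-trans i<d d≤k
... | tri≈ _ refl _ rewrite subst-var-≡ d V = Closed⇒Scoped V cV
... | tri> _ _ d<i@(s≤s _) rewrite subst-var-> V d<i = ℕP.≤-pred i<1+k
subst-Scoped V (tlam M)    cV d≤k sM        = subst-Scoped V M cV (s≤s d≤k) sM
subst-Scoped V (tapp M N)  cV d≤k (sM , sN) = subst-Scoped V M cV d≤k sM , subst-Scoped V N cV d≤k sN
subst-Scoped V (tpair M N) cV d≤k (sM , sN) = subst-Scoped V M cV d≤k sM , subst-Scoped V N cV d≤k sN
subst-Scoped V tπ₁   _ _ _ = tt
subst-Scoped V tπ₂   _ _ _ = tt
subst-Scoped V trec  _ _ _ = tt
subst-Scoped V tzero _ _ _ = tt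
subst-Scoped V tsuc  _ _ _ = tt
subst-Scoped V tR    _ _ _ = tt
subst-Scoped V tSR   _ _ _ = tt

subst-swap-var : ∀ d {V W} i → Closed V → Closed W →
                 subst d W (subst (suc d) V (tvar i)) ≡ subst d V (subst d W (tvar i))
subst-swap-var d {V} {W} i cV cW with ℕP.<-cmp i d
... | tri< i<d _ _
  rewrite subst-var-< V (ℕP.m<n⇒m<1+n i<d) | subst-var-< W i<d | subst-var-< V i<d = refl
... | tri≈ _ refl _
  rewrite subst-var-< V (ℕP.n<1+n d) | subst-var-≡ d W = sym (subst-id V W cW z≤n)
... | tri> _ _ (s≤s {n = j} d≤j) with ℕP.m≤n⇒m<n∨m≡n d≤j
...   | inj₁ d<j
  rewrite subst-var-> V (s≤s d<j) | subst-var-> W (s≤s d≤j)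
        | subst-var-> W d<j | subst-var-> V d<j = refl
...   | inj₂ refl
  rewrite subst-var-≡ (suc d) V | subst-var-> W (ℕP.n<1+n d) | subst-var-≡ d V = subst-id W V cV z≤n

subst-swap : ∀ d {V W} M → Closed V → Closed W →
             subst d W (subst (suc d) V M) ≡ subst d V (subst d W M)
subst-swap d (tvar i)    cV cW = subst-swap-var d i cV cW
subst-swap d (tlam M)    cV cW = cong tlam (subst-swap (suc d) M cV cW)
subst-swap d (tapp M N)  cV cW = cong₂ tapp (subst-swap d M cV cW) (subst-swap d N cV cW)
subst-swap d (tpair M N) cV cW = cong₂ tpair (subst-swap d M cV cW) (subst-swap d N cV cW)
subst-swap d tπ₁   _ _ = refl
subst-swap d tπ₂   _ _ = refl
subst-swap d trec  _ _ = refl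
subst-swap d tzero _ _ = refl
subst-swap d tsuc  _ _ = refl
subst-swap d tR    _ _ = refl
subst-swap d tSR   _ _ = refl

-- closeFrom d ρ M substitutes the closed terms of ρ for the indices d, d+1, … of M.
closeFrom : ℕ → List Term → Term → Term
closeFrom d []      M = M
closeFrom d (V ∷ ρ) M = closeFrom d ρ (subst d V M)

close : List Term → Term → Term
close = closeFrom 0

closeFrom-lam : ∀ d ρ M → closeFrom d ρ (tlam M) ≡ tlam (closeFrom (suc d) ρ M)
closeFrom-lam d []      M = refl
closeFrom-lam d (V ∷ ρ) M = closeFrom-lam d ρ (subst (suc d) V M)

closeFrom-app : ∀ d ρ M N → closeFrom d ρ (tapp M N) ≡ tapp (closeFrom d ρ M) (closeFrom d ρ N)
closeFrom-app d []      M N = refl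
closeFrom-app d (V ∷ ρ) M N = closeFrom-app d ρ (subst d V M) (subst d V N)

closeFrom-pair : ∀ d ρ M N → closeFrom d ρ (tpair M N) ≡ tpair (closeFrom d ρ M) (closeFrom d ρ N)
closeFrom-pair d []      M N = refl
closeFrom-pair d (V ∷ ρ) M N = closeFrom-pair d ρ (subst d V M) (subst d V N)

closeFrom-id : ∀ d ρ M → Scoped d M → closeFrom d ρ M ≡ M
closeFrom-id d []      M sM = refl
closeFrom-id d (V ∷ ρ) M sM rewrite subst-id V M sM ℕP.≤-refl = closeFrom-id d ρ M sM

closeFrom-subst : ∀ d {ρ W} M → All Closed ρ → Closed W →
                  subst d W (closeFrom (suc d) ρ M) ≡ closeFrom d ρ (subst d W M)
closeFrom-subst d M []           cW = refl
closeFrom-subst d {V ∷ ρ} {W} M (cV ∷ cρ) cW = begin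
  subst d W (closeFrom (suc d) ρ (subst (suc d) V M)) ≡⟨ closeFrom-subst d (subst (suc d) V M) cρ cW ⟩
  closeFrom d ρ (subst d W (subst (suc d) V M))       ≡⟨ cong (closeFrom d ρ) (subst-swap d M cV cW) ⟩
  closeFrom d ρ (subst d V (subst d W M))             ∎
  where open ≡-Reasoning

closeFrom-Scoped : ∀ d {ρ} M → All Closed ρ → Scoped (d ℕ.+ length ρ) M → Scoped d (closeFrom d ρ M)
closeFrom-Scoped d M [] sM rewrite ℕP.+-identityʳ d = sM
closeFrom-Scoped d {V ∷ ρ} M (cV ∷ cρ) sM =
  closeFrom-Scoped d (subst d V M) cρ
    (subst-Scoped V M cV (ℕP.m≤m+n d (length ρ)) (Eq.subst (λ k → Scoped k M) (ℕP.+-suc d (length ρ)) sM))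

∋⇒< : ∀ {Γ i σ} → Γ ∋ i ∶ σ → i < length Γ
∋⇒< here      = s≤s z≤n
∋⇒< (there x) = s≤s (∋⇒< x)

⊢⇒Scoped-star : ∀ {Γ M σ} → Γ ⊢ M ∶ σ → Scoped (length Γ) (star M)
⊢⇒Scoped-star (⊢var x)    = ∋⇒< x
⊢⇒Scoped-star (⊢lam d)    = ⊢⇒Scoped-star d
⊢⇒Scoped-star (⊢app d e)  = ⊢⇒Scoped-star d , ⊢⇒Scoped-star e
⊢⇒Scoped-star (⊢pair d e) = ⊢⇒Scoped-star d , ⊢⇒Scoped-star e
⊢⇒Scoped-star ⊢π₁   = tt
⊢⇒Scoped-star ⊢π₂   = tt
⊢⇒Scoped-star ⊢rec  = tt
⊢⇒Scoped-star ⊢zero = tt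
⊢⇒Scoped-star ⊢suc  = tt
⊢⇒Scoped-star ⊢R    = tt

-- Evaluation trees and reducibility

num-isValue : ∀ k → isValue (num k) ≡ true
num-isValue zero    = refl
num-isValue (suc k) = num-isValue k

num-Closed : ∀ k → Closed (num k)
num-Closed zero    = tt
num-Closed (suc k) = tt , num-Closed k

app-nonValue-arg : ∀ M N → isValue N ≡ false → isValue (tapp M N) ≡ false
app-nonValue-arg (tvar _)    _ _  = refl
app-nonValue-arg (tlam _)    _ _  = refl
app-nonValue-arg (tapp _ _)  _ _  = refl
app-nonValue-arg (tpair _ _) _ _  = refl
app-nonValue-arg tπ₁         _ _  = refl
app-nonValue-arg tπ₂         _ _  = refl
app-nonValue-arg trec        _ _  = refl
app-nonValue-arg tzero       _ _  = refl
app-nonValue-arg tsuc        _ N↑ = N↑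
app-nonValue-arg tR          _ _  = refl
app-nonValue-arg tSR         _ _  = refl

app-nonValue-fun : ∀ W M → isValue M ≡ false → isValue (tapp M W) ≡ false
app-nonValue-fun _ (tvar _)    _ = refl
app-nonValue-fun _ (tlam _)    ()
app-nonValue-fun _ (tapp _ _)  _ = refl
app-nonValue-fun _ (tpair _ _) _ = refl
app-nonValue-fun _ tπ₁         ()
app-nonValue-fun _ tπ₂         ()
app-nonValue-fun _ trec        ()
app-nonValue-fun _ tzero       ()
app-nonValue-fun _ tsuc        ()
app-nonValue-fun _ tR          _ = refl
app-nonValue-fun _ tSR         _ = refl

step-redex : ∀ M N m n → isValue M ≡ true → isValue N ≡ true → step (tapp M N) m n ≡ redex M N m n
step-redex M N m n M↓ N↓ rewrite N↓ | M↓ = refl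

module _ (n : ℕ) where

  branches : (Term → Term) → ℕ → List ℕ → Dist
  branches C m′ = map (λ k → (halfPow k , (C (num k) , m′ , n)))

  -- In sample, C is the evaluation context around the SR redex; the tree branches over every numeral.
  data Eval (Q : Term → Set) : Term → ℕ → Set where
    value  : ∀ {M m} → isValue M ≡ true → Q M → Eval Q M m
    det    : ∀ {M M′ m} → isValue M ≡ false → step M m n ≡ go ((1ℚ , (M′ , m , n)) ∷ []) →
             Eval Q M′ m → Eval Q M m
    sample : ∀ {M m} (C : Term → Term) → isValue M ≡ false →
             step M m n ≡ go (branches C (m ℕ.+ n) (upTo m)) →
             (∀ k → Eval Q (C (num k)) (m ℕ.+ n)) → Eval Q M m

  record EvalContext (C : Term → Term) : Set where
    field
      nonValue      : ∀ M → isValue M ≡ false → isValue (C M) ≡ false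
      step-commutes : ∀ M m → isValue M ≡ false → step (C M) m n ≡ mapS C (step M m n)
  open EvalContext

  bind : ∀ {C Q R M m} → EvalContext C → Eval Q M m →
         (∀ {V m′} → Q V → isValue V ≡ true → Eval R (C V) m′) → Eval R (C M) m
  bind E (value V↓ q) next = next q V↓
  bind {C} E (det {m = m} M↑ eq e) next =
    det (nonValue E _ M↑) (trans (step-commutes E _ m M↑) (cong (mapS C) eq)) (bind E e next)
  bind {C} E (sample {m = m} C₀ M↑ eq e) next =
    sample (C ∘ C₀) (nonValue E _ M↑)
      (trans (step-commutes E _ m M↑) (trans (cong (mapS C) eq) (cong go (sym (map-∘ (upTo m))))))
      (λ k → bind E (e k) next)

  argContext : ∀ M → EvalContext (tapp M)
  argContext M = record
    { nonValue      = app-nonValue-arg M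
    ; step-commutes = commutes
    }
    where
    commutes : ∀ N m → isValue N ≡ false → step (tapp M N) m n ≡ mapS (tapp M) (step N m n)
    commutes _ m N↑ rewrite N↑ = refl

  funContext : ∀ W → isValue W ≡ true → EvalContext (λ M → tapp M W)
  funContext W W↓ = record
    { nonValue      = app-nonValue-fun W
    ; step-commutes = commutes
    }
    where
    commutes : ∀ M m → isValue M ≡ false → step (tapp M W) m n ≡ mapS (λ M′ → tapp M′ W) (step M m n)
    commutes _ m M↑ rewrite W↓ | M↑ = refl

  pairLeftContext : ∀ N → EvalContext (λ M → tpair M N)
  pairLeftContext N = record
    { nonValue      = nonValue′
    ; step-commutes = commutes
    }
    where
    nonValue′ : ∀ M → isValue M ≡ false → isValue (tpair M N) ≡ false
    nonValue′ _ M↑ rewrite M↑ = refl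
    commutes : ∀ M m → isValue M ≡ false → step (tpair M N) m n ≡ mapS (λ M′ → tpair M′ N) (step M m n)
    commutes _ m M↑ rewrite M↑ = refl

  pairRightContext : ∀ V → isValue V ≡ true → EvalContext (tpair V)
  pairRightContext V V↓ = record
    { nonValue      = nonValue′
    ; step-commutes = commutes
    }
    where
    nonValue′ : ∀ N → isValue N ≡ false → isValue (tpair V N) ≡ false
    nonValue′ _ N↑ rewrite V↓ | N↑ = refl
    commutes : ∀ N m → isValue N ≡ false → step (tpair V N) m n ≡ mapS (tpair V) (step N m n)
    commutes _ m N↑ rewrite V↓ | N↑ = refl

  -- Closedness is part of the function clause because subst does not shift the term it substitutes.
  Red : Ty → Term → Set
  Red nat       V = ∃[ k ] V ≡ num k
  Red (σ ⇒ τ)   V = Closed V × isValue V ≡ true × (∀ W → Red σ W → ∀ m → Eval (Red τ) (tapp V W) m)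
  Red (σ ⊗ τ)   V = ∃₂ λ A B → V ≡ tpair A B × Red σ A × Red τ B

  Red⇒isValue : ∀ σ {V} → Red σ V → isValue V ≡ true
  Red⇒isValue nat     (k , refl)              = num-isValue k
  Red⇒isValue (σ ⇒ τ) (_ , V↓ , _)           = V↓
  Red⇒isValue (σ ⊗ τ) (_ , _ , refl , a , b)
    rewrite Red⇒isValue σ a | Red⇒isValue τ b = refl

  Red⇒Closed : ∀ σ {V} → Red σ V → Closed V
  Red⇒Closed nat     (k , refl)             = num-Closed k
  Red⇒Closed (σ ⇒ τ) (cV , _)               = cV
  Red⇒Closed (σ ⊗ τ) (_ , _ , refl , a , b) = Red⇒Closed σ a , Red⇒Closed τ b

  Red⇒Eval : ∀ σ {V m} → Red σ V → Eval (Red σ) V m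
  Red⇒Eval σ v = value (Red⇒isValue σ v) v

  Env : List Ty → List Term → Set
  Env = Pointwise Red

  Env⇒Closed : ∀ {Γ ρ} → Env Γ ρ → All Closed ρ
  Env⇒Closed []                  = []
  Env⇒Closed (_∷_ {σ} v env) = Red⇒Closed σ v ∷ Env⇒Closed env

  Env-lookup : ∀ {Γ ρ i σ} → Γ ∋ i ∶ σ → Env Γ ρ → Red σ (close ρ (tvar i))
  Env-lookup {σ = σ} here (_∷_ {y = V} {ys = ρ} v _)
    rewrite closeFrom-id 0 ρ V (Red⇒Closed σ v) = v
  Env-lookup (there x) (_ ∷ env) = Env-lookup x env

  rec-Eval : ∀ σ {U F} k → Red σ U → Red (nat ⇒ σ ⇒ σ) F → ∀ m →
             Eval (Red σ) (tapp trec (tpair U (tpair F (num k)))) m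
  rec-Eval σ {U} {F} zero u (_ , F↓ , _) m =
    det refl (step-redex trec (tpair U (tpair F tzero)) m n refl args↓) (Red⇒Eval σ u)
    where
    args↓ : isValue (tpair U (tpair F tzero)) ≡ true
    args↓ rewrite Red⇒isValue σ u | F↓ = refl
  rec-Eval σ {U} {F} (suc k) u f@(_ , F↓ , applyF) m =
    det refl (step-redex trec (tpair U (tpair F (num (suc k)))) m n refl args↓)
      (bind (argContext (tapp F (num k))) (rec-Eval σ k u f m) λ {X} x X↓ →
        bind (funContext X X↓) (applyF (num k) (k , refl) _) λ g _ →
          proj₂ (proj₂ g) X x _)
    where
    args↓ : isValue (tpair U (tpair F (num (suc k)))) ≡ true
    args↓ rewrite Red⇒isValue σ u | F↓ | num-isValue k = refl

  fundamental : ∀ {Γ M σ ρ} → Γ ⊢ M ∶ σ → Env Γ ρ → ∀ m → Eval (Red σ) (close ρ (star M)) m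
  fundamental {σ = σ} (⊢var x) env m = Red⇒Eval σ (Env-lookup x env)
  fundamental {Γ} {tlam B} {σ ⇒ τ} {ρ} (⊢lam d) env m
    rewrite closeFrom-lam 0 ρ (star B) = value refl (closed , refl , body)
    where
    closed : Scoped 1 (closeFrom 1 ρ (star B))
    closed = closeFrom-Scoped 1 (star B) (Env⇒Closed env)
               (Eq.subst (λ k → Scoped (suc k) (star B)) (Pointwise-length env) (⊢⇒Scoped-star d))
    body : ∀ W → Red σ W → ∀ m′ → Eval (Red τ) (tapp (tlam (closeFrom 1 ρ (star B))) W) m′
    body W w m′ =
      det refl (step-redex _ W m′ n refl (Red⇒isValue σ w))
        (Eq.subst (λ t → Eval (Red τ) t m′)
          (sym (closeFrom-subst 0 (star B) (Env⇒Closed env) (Red⇒Closed σ w)))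
          (fundamental d (w ∷ env) m′))
  fundamental {ρ = ρ} (⊢app {M = M} {N} dM dN) env m
    rewrite closeFrom-app 0 ρ (star M) (star N) =
    bind (argContext _) (fundamental dN env m) λ {W} w W↓ →
      bind (funContext W W↓) (fundamental dM env _) λ f _ →
        proj₂ (proj₂ f) W w _
  fundamental {σ = σ ⊗ τ} {ρ} (⊢pair {M = M} {N} dM dN) env m
    rewrite closeFrom-pair 0 ρ (star M) (star N) =
    bind (pairLeftContext _) (fundamental dM env m) λ {A} a A↓ →
      bind (pairRightContext A A↓) (fundamental dN env _) λ {B} b _ →
        Red⇒Eval (σ ⊗ τ) (A , B , refl , a , b)
  fundamental {σ = (σ ⊗ τ) ⇒ _} {ρ} ⊢π₁ env m
    rewrite closeFrom-id 0 ρ tπ₁ tt = value refl (tt , refl , first)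
    where
    first : ∀ W → Red (σ ⊗ τ) W → ∀ m′ → Eval (Red σ) (tapp tπ₁ W) m′
    first _ p@(A , B , refl , a , _) m′ =
      det refl (step-redex tπ₁ (tpair A B) m′ n refl (Red⇒isValue (σ ⊗ τ) p)) (Red⇒Eval σ a)
  fundamental {σ = (σ ⊗ τ) ⇒ _} {ρ} ⊢π₂ env m
    rewrite closeFrom-id 0 ρ tπ₂ tt = value refl (tt , refl , second)
    where
    second : ∀ W → Red (σ ⊗ τ) W → ∀ m′ → Eval (Red τ) (tapp tπ₂ W) m′
    second _ p@(A , B , refl , _ , b) m′ =
      det refl (step-redex tπ₂ (tpair A B) m′ n refl (Red⇒isValue (σ ⊗ τ) p)) (Red⇒Eval τ b)
  fundamental {σ = _ ⇒ σ} {ρ} ⊢rec env m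
    rewrite closeFrom-id 0 ρ trec tt = value refl (tt , refl , recursor)
    where
    recursor : ∀ W → Red (σ ⊗ ((nat ⇒ σ ⇒ σ) ⊗ nat)) W → ∀ m′ → Eval (Red σ) (tapp trec W) m′
    recursor _ (_ , _ , refl , u , _ , _ , refl , f , k , refl) m′ = rec-Eval σ k u f m′
  fundamental {ρ = ρ} ⊢zero env m
    rewrite closeFrom-id 0 ρ tzero tt = Red⇒Eval nat (0 , refl)
  fundamental {ρ = ρ} ⊢suc env m
    rewrite closeFrom-id 0 ρ tsuc tt = value refl (tt , refl , successor)
    where
    successor : ∀ W → Red nat W → ∀ m′ → Eval (Red nat) (tapp tsuc W) m′
    successor _ (k , refl) m′ = Red⇒Eval nat (suc k , refl)
  fundamental {ρ = ρ} ⊢R env m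
    rewrite closeFrom-id 0 ρ tSR tt = sample id refl refl (λ k → Red⇒Eval nat (k , refl))

-- Powers of one half

ℚ-ring : AlmostCommutativeRing 0ℓ 0ℓ
ℚ-ring = fromCommutativeRing QP.+-*-commutativeRing (λ x → dec⇒maybe (0ℚ QP.≟ x))

≤-by-nonNeg-gap : ∀ {p q} r → 0ℚ ℚ.≤ r → p + r ≡ q → p ℚ.≤ q
≤-by-nonNeg-gap {p} r 0≤r refl = begin
  p        ≡⟨ sym (QP.+-identityʳ p) ⟩
  p + 0ℚ   ≤⟨ QP.+-monoʳ-≤ p 0≤r ⟩
  p + r    ∎
  where open QP.≤-Reasoning

*-nonNeg : ∀ {p q} → 0ℚ ℚ.≤ p → 0ℚ ℚ.≤ q → 0ℚ ℚ.≤ p * q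
*-nonNeg {p} {q} 0≤p 0≤q = QP.nonNegative⁻¹ _
  {{QP.nonNeg*nonNeg⇒nonNeg p {{ℚ.nonNegative 0≤p}} q {{ℚ.nonNegative 0≤q}}}}

p-q≤p : ∀ {p q} → 0ℚ ℚ.≤ q → p - q ℚ.≤ p
p-q≤p {p} {q} 0≤q = begin
  p - q     ≤⟨ QP.+-monoʳ-≤ p (QP.neg-antimono-≤ 0≤q) ⟩
  p + 0ℚ    ≡⟨ QP.+-identityʳ p ⟩
  p         ∎
  where open QP.≤-Reasoning

½^_ : ℕ → ℚ
½^ zero  = 1ℚ
½^ suc m = ½ * ½^ m

deficit : ℕ → ℚ
deficit m = ½^ m + ½^ m

halves : ∀ p → ½ * p + ½ * p ≡ p
halves = solve-∀ ℚ-ring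

½^-nonNeg : ∀ m → 0ℚ ℚ.≤ ½^ m
½^-nonNeg zero    = QP.nonNegative⁻¹ 1ℚ
½^-nonNeg (suc m) = *-nonNeg (QP.nonNegative⁻¹ ½) (½^-nonNeg m)

deficit-nonNeg : ∀ m → 0ℚ ℚ.≤ deficit m
deficit-nonNeg m = QP.+-mono-≤ (½^-nonNeg m) (½^-nonNeg m)

½^-suc≤ : ∀ m → ½^ suc m ℚ.≤ ½^ m
½^-suc≤ m = ≤-by-nonNeg-gap (½^ suc m) (½^-nonNeg (suc m)) (halves (½^ m))

½^-antitone : ∀ m j → ½^ (m ℕ.+ j) ℚ.≤ ½^ m
½^-antitone m zero    rewrite ℕP.+-identityʳ m = QP.≤-refl
½^-antitone m (suc j) rewrite ℕP.+-suc m j = QP.≤-trans (½^-suc≤ (m ℕ.+ j)) (½^-antitone m j)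

deficit-+-suc≤ : ∀ m j → deficit (m ℕ.+ suc j) ℚ.≤ ½^ m
deficit-+-suc≤ m j = begin
  deficit (m ℕ.+ suc j)     ≤⟨ QP.+-mono-≤ later later ⟩
  ½^ suc m + ½^ suc m      ≡⟨ halves (½^ m) ⟩
  ½^ m                     ∎
  where
  open QP.≤-Reasoning
  later : ½^ (m ℕ.+ suc j) ℚ.≤ ½^ suc m
  later rewrite ℕP.+-suc m j = ½^-antitone (suc m) j

halfPow-nonNeg : ∀ k → 0ℚ ℚ.≤ halfPow k
halfPow-nonNeg zero    = QP.nonNegative⁻¹ ½
halfPow-nonNeg (suc k) = *-nonNeg (QP.nonNegative⁻¹ ½) (halfPow-nonNeg k)

halfPowSum : List ℕ → ℚ
halfPowSum = foldr (λ k s → halfPow k + s) 0ℚ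

halfPowSum-map-suc : ∀ ks → halfPowSum (map suc ks) ≡ ½ * halfPowSum ks
halfPowSum-map-suc []       = sym (QP.*-zeroʳ ½)
halfPowSum-map-suc (k ∷ ks) = begin
  ½ * halfPow k + halfPowSum (map suc ks)   ≡⟨ cong (λ s → ½ * halfPow k + s) (halfPowSum-map-suc ks) ⟩
  ½ * halfPow k + ½ * halfPowSum ks         ≡⟨ sym (QP.*-distribˡ-+ ½ (halfPow k) (halfPowSum ks)) ⟩
  ½ * (halfPow k + halfPowSum ks)           ∎
  where open ≡-Reasoning

halfPowSum-upTo : ∀ m → halfPowSum (upTo m) ≡ 1ℚ - ½^ m
halfPowSum-upTo zero    = refl
halfPowSum-upTo (suc m) = begin
  ½ + halfPowSum (applyUpTo suc m)     ≡⟨ cong (λ ks → ½ + halfPowSum ks) (sym (map-applyUpTo id suc m)) ⟩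
  ½ + halfPowSum (map suc (upTo m))    ≡⟨ cong (λ s → ½ + s) (halfPowSum-map-suc (upTo m)) ⟩
  ½ + ½ * halfPowSum (upTo m)          ≡⟨ cong (λ s → ½ + ½ * s) (halfPowSum-upTo m) ⟩
  ½ + ½ * (1ℚ - ½^ m)                  ≡⟨ identity (½^ m) ⟩
  1ℚ - ½ * ½^ m                        ∎
  where
  open ≡-Reasoning
  identity : ∀ x → ½ + ½ * (1ℚ - x) ≡ 1ℚ - ½ * x
  identity = solve-∀ ℚ-ring

deficit-step : ∀ m j → 1ℚ - deficit m ℚ.≤ (1ℚ - ½^ m) * (1ℚ - deficit (m ℕ.+ suc j))
deficit-step m j = begin
  1ℚ - (E + E)
    ≤⟨ QP.+-monoʳ-≤ 1ℚ (QP.neg-antimono-≤ (QP.+-monoʳ-≤ E (deficit-+-suc≤ m j))) ⟩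
  1ℚ - (E + F)
    ≡⟨ sym (QP.+-identityʳ _) ⟩
  1ℚ - (E + F) + 0ℚ
    ≤⟨ QP.+-monoʳ-≤ (1ℚ - (E + F)) (*-nonNeg (½^-nonNeg m) (deficit-nonNeg (m ℕ.+ suc j))) ⟩
  1ℚ - (E + F) + E * F
    ≡⟨ expand E F ⟩
  (1ℚ - E) * (1ℚ - F)
    ∎
  where
  open QP.≤-Reasoning
  E = ½^ m
  F = deficit (m ℕ.+ suc j)
  expand : ∀ E F → 1ℚ - (E + F) + E * F ≡ (1ℚ - E) * (1ℚ - F)
  expand = solve-∀ ℚ-ring

½*recipℕ≤recipℕ : ∀ k → ½ * recipℕ (suc k) ℚ.≤ recipℕ (suc (suc k))
½*recipℕ≤recipℕ k = QP.toℚᵘ-cancel-≤ (begin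
  toℚᵘ (½ * recipℕ (suc k))       ≃⟨ QP.toℚᵘ-homo-* ½ (recipℕ (suc k)) ⟩
  toℚᵘ ½ ℚᵘ.* toℚᵘ (recipℕ (suc k)) ≃⟨ ℚᵘP.*-congˡ {toℚᵘ ½} (QP.toℚᵘ-fromℚᵘ (1/[1+ k ])) ⟩
  toℚᵘ ½ ℚᵘ.* 1/[1+ k ]            ≤⟨ ℚᵘ.*≤* (ℤ.+≤+ cross) ⟩
  1/[1+ suc k ]                    ≃⟨ ℚᵘP.≃-sym (QP.toℚᵘ-fromℚᵘ (1/[1+ suc k ])) ⟩
  toℚᵘ (recipℕ (suc (suc k)))     ∎)
  where
  open ℚᵘP.≤-Reasoning
  1/[1+_] : ℕ → ℚᵘ.ℚᵘ
  1/[1+ j ] = ℚᵘ.mkℚᵘ (ℤ.+ 1) j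
  -- 2 + k ≤ 2 (1 + k), in the shape the cross-multiplication in ℚᵘ unfolds to
  cross : suc (suc (k ℕ.+ 0)) ≤ suc (k ℕ.+ suc (k ℕ.+ 0) ℕ.+ 0)
  cross rewrite ℕP.+-identityʳ k | ℕP.+-identityʳ (k ℕ.+ suc k) = s≤s (ℕP.m≤n+m (suc k) k)

deficit≤recipℕ : ∀ k → deficit (4 ℕ.+ k) ℚ.≤ recipℕ (4 ℕ.+ k)
deficit≤recipℕ zero    = toWitness {a? = deficit 4 QP.≤? recipℕ 4} _
deficit≤recipℕ (suc k) = begin
  ½ * E + ½ * E         ≡⟨ sym (QP.*-distribˡ-+ ½ E E) ⟩
  ½ * deficit (4 ℕ.+ k) ≤⟨ QP.*-monoˡ-≤-nonNeg ½ (deficit≤recipℕ k) ⟩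
  ½ * recipℕ (4 ℕ.+ k)  ≤⟨ ½*recipℕ≤recipℕ (3 ℕ.+ k) ⟩
  recipℕ (5 ℕ.+ k)      ∎
  where
  open QP.≤-Reasoning
  E = ½^ (4 ℕ.+ k)

-- Distributions that settle

Settled : Dist → Set
Settled = All λ { (_ , (t , _)) → isValue t ≡ true }

liftStep-settled : ∀ {D} → Settled D → liftStep D ≡ D
liftStep-settled {[]}                 []         = refl
liftStep-settled {(p , (t , c)) ∷ D} (t↓ ∷ D↓) rewrite t↓ = cong (_ ∷_) (liftStep-settled D↓)

iterate-settled : ∀ k {D} → Settled D → iterate k D ≡ D
iterate-settled zero    D↓ = refl
iterate-settled (suc k) D↓ rewrite liftStep-settled D↓ = iterate-settled k D↓

iterate-+ : ∀ j k D → iterate (j ℕ.+ k) D ≡ iterate k (iterate j D)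
iterate-+ zero    k D = refl
iterate-+ (suc j) k D = iterate-+ j k (liftStep D)

liftStep-++ : ∀ D E → liftStep (D ++ E) ≡ liftStep D ++ liftStep E
liftStep-++ = concatMap-++ _

iterate-++ : ∀ k D E → iterate k (D ++ E) ≡ iterate k D ++ iterate k E
iterate-++ zero    D E = refl
iterate-++ (suc k) D E rewrite liftStep-++ D E = iterate-++ k (liftStep D) (liftStep E)

iterate-stable : ∀ j k D → Settled (iterate j D) → iterate (j ℕ.+ k) D ≡ iterate j D
iterate-stable j k D settled = trans (iterate-+ j k D) (iterate-settled k settled)

valueMass-++ : ∀ D E → valueMass (D ++ E) ≡ valueMass D + valueMass E
valueMass-++ []                  E = sym (QP.+-identityˡ _)
valueMass-++ ((p , (t , c)) ∷ D) E with isValue t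
... | true  = trans (cong (p +_) (valueMass-++ D E)) (sym (QP.+-assoc p _ _))
... | false = valueMass-++ D E

SettlesWith : Dist → ℚ → Set
SettlesWith D q = ∃[ k ] Settled (iterate k D) × q ℚ.≤ valueMass (iterate k D)

settles-[] : SettlesWith [] 0ℚ
settles-[] = 0 , [] , QP.≤-refl

settles-value : ∀ p {t} c → isValue t ≡ true → SettlesWith ((p , (t , c)) ∷ []) p
settles-value p {t} c t↓ = 0 , t↓ ∷ [] , mass
  where
  mass : p ℚ.≤ valueMass ((p , (t , c)) ∷ [])
  mass rewrite t↓ = QP.≤-reflexive (sym (QP.+-identityʳ p))

settles-weaken : ∀ {D q r} → q ℚ.≤ r → SettlesWith D r → SettlesWith D q
settles-weaken q≤r (k , settled , r≤) = k , settled , QP.≤-trans q≤r r≤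

settles-liftStep : ∀ {D D′ q} → liftStep D ≡ D′ → SettlesWith D′ q → SettlesWith D q
settles-liftStep refl (k , settled , q≤) = suc k , settled , q≤

settles-++ : ∀ {D E q r} → SettlesWith D q → SettlesWith E r → SettlesWith (D ++ E) (q + r)
settles-++ {D} {E} {q} {r} (j , D↓ , q≤) (k , E↓ , r≤) =
  j ℕ.+ k , Eq.subst (λ X → Settled X × q + r ℚ.≤ valueMass X) (sym both) (++⁺ D↓ E↓ , mass)
  where
  both : iterate (j ℕ.+ k) (D ++ E) ≡ iterate j D ++ iterate k E
  both = trans (iterate-++ (j ℕ.+ k) D E)
           (cong₂ _++_ (iterate-stable j k D D↓)
             (trans (cong (λ i → iterate i E) (ℕP.+-comm j k)) (iterate-stable k j E E↓)))
  mass : q + r ℚ.≤ valueMass (iterate j D ++ iterate k E)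
  mass = QP.≤-trans (QP.+-mono-≤ q≤ r≤) (QP.≤-reflexive (sym (valueMass-++ (iterate j D) (iterate k E))))

-- Mass bound along evaluation trees

module _ (n′ : ℕ) where

  private
    n : ℕ
    n = suc n′

  weightedBranches : ℚ → (Term → Term) → ℕ → List ℕ → Dist
  weightedBranches p C m′ = map (λ k → (p * halfPow k , (C (num k) , m′ , n)))

  liftStep-det : ∀ p M {M′ m} → isValue M ≡ false → step M m n ≡ go ((1ℚ , (M′ , m , n)) ∷ []) →
                 liftStep ((p , (M , m , n)) ∷ []) ≡ (p , (M′ , m , n)) ∷ []
  liftStep-det p M M↑ eq rewrite M↑ | eq = cong (λ q → (q , _) ∷ []) (QP.*-identityʳ p)

  liftStep-sample : ∀ p C M {m m′} ks → isValue M ≡ false → step M m n ≡ go (branches n C m′ ks) →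
                    liftStep ((p , (M , m , n)) ∷ []) ≡ weightedBranches p C m′ ks
  liftStep-sample p C M ks M↑ eq rewrite M↑ | eq = trans (++-identityʳ _) (sym (map-∘ ks))

  mutual
    Eval-settles : ∀ {Q M m} → Eval n Q M m → ∀ p → 0ℚ ℚ.≤ p →
                   SettlesWith ((p , (M , m , n)) ∷ []) (p * (1ℚ - deficit m))
    Eval-settles {m = m} (value M↓ _) p 0≤p =
      settles-weaken (≤-by-nonNeg-gap (p * deficit m) (*-nonNeg 0≤p (deficit-nonNeg m)) (split p (deficit m)))
        (settles-value p _ M↓)
      where
      split : ∀ p d → p * (1ℚ - d) + p * d ≡ p
      split = solve-∀ ℚ-ring
    Eval-settles {M = M} (det M↑ eq e) p 0≤p =
      settles-liftStep (liftStep-det p M M↑ eq) (Eval-settles e p 0≤p)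
    Eval-settles {M = M} {m} (sample C M↑ eq e) p 0≤p =
      settles-liftStep (liftStep-sample p C M (upTo m) M↑ eq)
        (settles-weaken survival (branches-settle C e p 0≤p (upTo m)))
      where
      open QP.≤-Reasoning
      later : ℚ
      later = 1ℚ - deficit (m ℕ.+ n)
      survival : p * (1ℚ - deficit m) ℚ.≤ p * halfPowSum (upTo m) * later
      survival = begin
        p * (1ℚ - deficit m)           ≤⟨ QP.*-monoˡ-≤-nonNeg p {{ℚ.nonNegative 0≤p}} (deficit-step m n′) ⟩
        p * ((1ℚ - ½^ m) * later)      ≡⟨ sym (QP.*-assoc p _ _) ⟩
        p * (1ℚ - ½^ m) * later        ≡⟨ cong (λ s → p * s * later) (sym (halfPowSum-upTo m)) ⟩
        p * halfPowSum (upTo m) * later ∎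

    branches-settle : ∀ {Q} C {m′} → (∀ k → Eval n Q (C (num k)) m′) → ∀ p → 0ℚ ℚ.≤ p → ∀ ks →
                      SettlesWith (weightedBranches p C m′ ks) (p * halfPowSum ks * (1ℚ - deficit m′))
    branches-settle C {m′} e p 0≤p [] =
      settles-weaken (QP.≤-reflexive (vanish p (deficit m′))) settles-[]
      where
      vanish : ∀ p d → p * 0ℚ * (1ℚ - d) ≡ 0ℚ
      vanish = solve-∀ ℚ-ring
    branches-settle C {m′} e p 0≤p (k ∷ ks) =
      settles-weaken (QP.≤-reflexive (distrib p (halfPow k) (halfPowSum ks) (deficit m′)))
        (settles-++ (Eval-settles (e k) (p * halfPow k) (*-nonNeg 0≤p (halfPow-nonNeg k)))
                    (branches-settle C e p 0≤p ks))
      where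
      distrib : ∀ p h s d → p * (h + s) * (1ℚ - d) ≡ p * h * (1ℚ - d) + p * s * (1ℚ - d)
      distrib = solve-∀ ℚ-ring

mainTheorem17 : (N : Term) (σ : Ty) → [] ⊢ N ∶ σ →
                (n : ℕ) → 4 ≤ n →
                SuccAtLeast (star N) n n (1ℚ - recipℕ n)
mainTheorem17 N σ ⊢N n@(suc (suc (suc (suc k)))) (s≤s (s≤s (s≤s (s≤s z≤n)))) ε 0<ε
  with Eval-settles (3 ℕ.+ k) (fundamental n ⊢N [] n) 1ℚ (QP.nonNegative⁻¹ 1ℚ)
... | j , _ , mass≥ = j , (begin
  1ℚ - recipℕ n - ε         ≤⟨ p-q≤p (QP.<⇒≤ 0<ε) ⟩
  1ℚ - recipℕ n             ≤⟨ QP.+-monoʳ-≤ 1ℚ (QP.neg-antimono-≤ (deficit≤recipℕ k)) ⟩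
  1ℚ - deficit n            ≡⟨ sym (QP.*-identityˡ _) ⟩
  1ℚ * (1ℚ - deficit n)     ≤⟨ mass≥ ⟩
  valueMass (iterate j ((1ℚ , (star N , n , n)) ∷ [])) ∎)
  where open QP.≤-Reasoning
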